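{- For $i\ge1$ let $\alpha_i=C_{i-1}+\delta_{i,1}$, where $C_m=\frac{1}{m+1}\binom{2m}{m}$ is the $m$th Catalan number and $\delta_{i,1}$ is the Kronecker delta. Then for every integer $d\ge1$, $$\binom{2d}{d}=\sum_{\mathcal P}\alpha_{a_1}\alpha_{a_2}\cdots\alpha_{a_k},$$ where the sum is over all cyclic compositions $\mathcal P=\{\mathcal B_1,\ldots,\mathcal B_k\}$ of $d$ (with any number $k\ge1$ of parts) and $a_i=|\mathcal B_i|$.
   Context: Let $\mathbb Z_d$ denote the integers modulo $d$, viewed also as the cycle graph on $d$ labeled vertices in which $i$ and $i+1$ (mod $d$) are adjacent. A cyclic composition of $d$ into $k$ parts is a set partition $\mathcal P=\{\mathcal B_1,\ldots,\mathcal B_k\}$ of $\mathbb Z_d$ in which each block $\mathcal B_i$ is the image of an interval of integers $[p_i,q_i]$ with $0\le q_i-p_i\le d-1$ under the quotient map $\mathbb Z\to\mathbb Z_d$ (equivalently, a subgraph of the cycle obtained by deleting $k\ge1$ edges, whose $k$ components are paths; the whole cycle is not allowed). The size of a part is $|\mathcal B_i|=q_i-p_i+1$. -}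

module Defs where

open import Data.Nat using (ℕ; zero; suc; _+_; _*_; _∸_; _/_)
open import Data.Nat.Combinatorics using (_C_)
open import Data.Bool using (Bool; true; false)
open import Data.Fin using (Fin; toℕ)
open import Data.Fin.Subset using (Subset; _∈_)
open import Data.Vec using (Vec; []; _∷_)
open import Data.List using (List; []; _∷_; _++_; [_]; map)
open import Data.Nat.ListAction using (sum; product)

catalan : ℕ → ℕ
catalan m = ((2 * m) C m) / suc m

δ₁ : ℕ → ℕ
δ₁ 1 = 1
δ₁ _ = 0

-- α_i = C_{i-1} + δ_{i,1}   (only used for i ≥ 1)
α : ℕ → ℕ
α i = catalan (i ∸ 1) + δ₁ i

allSubsets : (n : ℕ) → List (Subset n)
allSubsets zero = [] ∷ []
allSubsets (suc n) = map (true ∷_) (allSubsets n) ++ map (false ∷_) (allSubsets n)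

-- The edges of the cycle graph Z_d are indexed by Fin d: edge i joins
-- vertices i and i+1 (mod d).  A cyclic composition of d is given by the
-- nonempty set S ⊆ Fin d of deleted edges.
cutPositions : {n : ℕ} → Subset n → List ℕ
cutPositions [] = []
cutPositions (true ∷ s) = 0 ∷ map suc (cutPositions s)
cutPositions (false ∷ s) = map suc (cutPositions s)

-- Given increasing cut positions c₁ < … < c_k (k ≥ 1) in {0,…,d-1},
-- the components of the cycle minus these edges are the vertex sets
-- {c_j+1, …, c_{j+1}} (j < k) and {c_k+1, …, d-1, 0, …, c₁} (wrapping),
-- of sizes c_{j+1} - c_j and d - c_k + c₁.
gapsFrom : ℕ → ℕ → List ℕ → List ℕ
gapsFrom d c₁ [] = []
gapsFrom d c₁ (c ∷ []) = (d ∸ c) + c₁ ∷ []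
gapsFrom d c₁ (c ∷ c' ∷ rest) = (c' ∸ c) ∷ gapsFrom d c₁ (c' ∷ rest)

partSizesOfCuts : ℕ → List ℕ → List ℕ
partSizesOfCuts d [] = []
partSizesOfCuts d (c ∷ cs) = gapsFrom d c (c ∷ cs)

partSizes : {d : ℕ} → Subset d → List ℕ
partSizes {d} S = partSizesOfCuts d (cutPositions S)

-- Weight α_{a₁}⋯α_{a_k} of a cyclic composition; the empty set of deleted
-- edges (whole cycle) is not a cyclic composition and gets weight 0.
weight : {d : ℕ} → Subset d → ℕ
weight S with cutPositions S
... | [] = 0
... | _ ∷ _ = product (map α (partSizes S))

cyclicSum : ℕ → ℕ
cyclicSum d = sum (map weight (allSubsets d))

-- Work with generating functions, as coefficient sequences over ℕ. Let c be the
-- Catalan series, so c = 1 + x c², and A(x) = Σ αᵢ xⁱ = x (c + 1). Read a cyclic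
-- composition starting from vertex 0: the part containing vertex 0, of size a,
-- can sit in a positions and weighs α_a, and the other parts form a linear
-- composition, counted by 1 / (1 − A) = c². So the sum for d + 1 is the
-- coefficient of x^d in A′ c², where A′ = 1 + Σ C(2j, j) xʲ. Finally the
-- coefficients of cᵏ are ballot numbers, [xⁿ] cᵏ / √(1 − 4x) = C(2n + k, n), and
-- [x^d] c² = C(2d + 2, d + 1) − C(2d + 2, d).
module Submission where

open import Defs
open import Data.Bool using (true; false)
open import Data.Fin.Subset using (Subset)
open import Data.List using (List; []; _∷_; _++_; map)
open import Data.List.Properties using (map-++; map-∘; map-cong; map-id)
open import Data.Nat
open import Data.Nat.Combinatorics
  using (_C_; nCk≡nC[n∸k]; nC1≡n; nCk+nC[k+1]≡[n+1]C[k+1]; k>n⇒nCk≡0)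
open import Data.Nat.DivMod using (m*n/n≡m)
open import Data.Nat.ListAction using (sum; product)
open import Data.Nat.ListAction.Properties using (sum-++)
open import Data.Nat.Properties
open import Algebra.Properties.CommutativeSemigroup +-commutativeSemigroup
  using (interchange; xy∙z≈x∙zy)
open import Data.Nat.Tactic.RingSolver using (solve-∀)
open import Data.Vec using ([]; _∷_)
open import Function using (_∘_)
open import Relation.Binary.PropositionalEquality
open ≡-Reasoning

Series : Set
Series = ℕ → ℕ

infixl 6 _⊕_
infixl 7 _∗_
infixr 8 _·_

tail : Series → Series
tail a i = a (suc i)

shift : Series → Series
shift a zero = 0
shift a (suc n) = a n

𝟘 𝟙 : Series
𝟘 _ = 0
𝟙 zero = 1
𝟙 (suc _) = 0

_⊕_ : Series → Series → Series
(a ⊕ b) n = a n + b n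

_·_ : ℕ → Series → Series
(k · a) n = k * a n

_∗_ : Series → Series → Series
(a ∗ b) zero = a 0 * b 0
(a ∗ b) (suc n) = a 0 * b (suc n) + (tail a ∗ b) n

shift-cong : ∀ {a b} → a ≗ b → shift a ≗ shift b
shift-cong e zero = refl
shift-cong e (suc n) = e n

∗-cong : ∀ {a a′ b b′} → a ≗ a′ → b ≗ b′ → a ∗ b ≗ a′ ∗ b′
∗-cong ea eb zero = cong₂ _*_ (ea 0) (eb 0)
∗-cong ea eb (suc n) = cong₂ _+_ (cong₂ _*_ (ea 0) (eb (suc n))) (∗-cong (ea ∘ suc) eb n)

∗-congˡ : ∀ {a a′} b → a ≗ a′ → a ∗ b ≗ a′ ∗ b
∗-congˡ b e = ∗-cong e (λ _ → refl)

∗-congʳ : ∀ a {b b′} → b ≗ b′ → a ∗ b ≗ a ∗ b′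
∗-congʳ a e = ∗-cong (λ _ → refl) e

∗-congʳ-≤ : ∀ {b b′} a n → (∀ {i} → i ≤ n → b i ≡ b′ i) → (a ∗ b) n ≡ (a ∗ b′) n
∗-congʳ-≤ a zero e = cong (a 0 *_) (e z≤n)
∗-congʳ-≤ a (suc n) e =
  cong₂ _+_ (cong (a 0 *_) (e ≤-refl)) (∗-congʳ-≤ (tail a) n (e ∘ m≤n⇒m≤1+n))

∗-distribˡ-⊕ : ∀ a b b′ → a ∗ (b ⊕ b′) ≗ a ∗ b ⊕ a ∗ b′
∗-distribˡ-⊕ a b b′ zero = *-distribˡ-+ (a 0) (b 0) (b′ 0)
∗-distribˡ-⊕ a b b′ (suc n) = trans
  (cong₂ _+_ (*-distribˡ-+ (a 0) (b (suc n)) (b′ (suc n))) (∗-distribˡ-⊕ (tail a) b b′ n))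
  (interchange (a 0 * b (suc n)) (a 0 * b′ (suc n)) ((tail a ∗ b) n) ((tail a ∗ b′) n))

∗-distribʳ-⊕ : ∀ a a′ b → (a ⊕ a′) ∗ b ≗ a ∗ b ⊕ a′ ∗ b
∗-distribʳ-⊕ a a′ b zero = *-distribʳ-+ (b 0) (a 0) (a′ 0)
∗-distribʳ-⊕ a a′ b (suc n) = trans
  (cong₂ _+_ (*-distribʳ-+ (b (suc n)) (a 0) (a′ 0)) (∗-distribʳ-⊕ (tail a) (tail a′) b n))
  (interchange (a 0 * b (suc n)) (a′ 0 * b (suc n)) ((tail a ∗ b) n) ((tail a′ ∗ b) n))

∗-shiftˡ : ∀ a b → shift a ∗ b ≗ shift (a ∗ b)
∗-shiftˡ a b zero = refl
∗-shiftˡ a b (suc n) = refl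

∗-shiftʳ : ∀ a b → a ∗ shift b ≗ shift (a ∗ b)
∗-shiftʳ a b zero = *-zeroʳ (a 0)
∗-shiftʳ a b (suc zero) = trans (cong (a 0 * b 0 +_) (*-zeroʳ (a 1))) (+-identityʳ _)
∗-shiftʳ a b (suc (suc n)) = cong (a 0 * b (suc n) +_) (∗-shiftʳ (tail a) b (suc n))

∗-zeroˡ : ∀ b → 𝟘 ∗ b ≗ 𝟘
∗-zeroˡ b zero = refl
∗-zeroˡ b (suc n) = ∗-zeroˡ b n

∗-identityˡ : ∀ b → 𝟙 ∗ b ≗ b
∗-identityˡ b zero = *-identityˡ (b 0)
∗-identityˡ b (suc n) =
  trans (cong (1 * b (suc n) +_) (∗-zeroˡ b n)) (trans (+-identityʳ _) (*-identityˡ _))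

∗-identityʳ : ∀ a → a ∗ 𝟙 ≗ a
∗-identityʳ a zero = *-identityʳ (a 0)
∗-identityʳ a (suc n) = trans (cong (_+ (tail a ∗ 𝟙) n) (*-zeroʳ (a 0))) (∗-identityʳ (tail a) n)

∗-scaleˡ : ∀ k a b → (k · a) ∗ b ≗ k · (a ∗ b)
∗-scaleˡ k a b zero = *-assoc k (a 0) (b 0)
∗-scaleˡ k a b (suc n) = trans
  (cong₂ _+_ (*-assoc k (a 0) (b (suc n))) (∗-scaleˡ k (tail a) b n))
  (sym (*-distribˡ-+ k _ _))

∗-unfoldˡ : ∀ a b → a ∗ b ≗ a 0 · b ⊕ shift (tail a ∗ b)
∗-unfoldˡ a b zero = sym (+-identityʳ _)
∗-unfoldˡ a b (suc n) = refl

∗-assoc : ∀ a b c → (a ∗ b) ∗ c ≗ a ∗ (b ∗ c)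
∗-assoc a b c zero = *-assoc (a 0) (b 0) (c 0)
∗-assoc a b c (suc n) = begin
  ((a ∗ b) ∗ c) (suc n)
    ≡⟨ ∗-congˡ c (∗-unfoldˡ a b) (suc n) ⟩
  ((a 0 · b ⊕ shift (tail a ∗ b)) ∗ c) (suc n)
    ≡⟨ ∗-distribʳ-⊕ (a 0 · b) (shift (tail a ∗ b)) c (suc n) ⟩
  ((a 0 · b) ∗ c) (suc n) + ((tail a ∗ b) ∗ c) n
    ≡⟨ cong₂ _+_ (∗-scaleˡ (a 0) b c (suc n)) (∗-assoc (tail a) b c n) ⟩
  (a ∗ (b ∗ c)) (suc n) ∎

-- The coefficient of xⁿ⁺¹ in u + x (a ∗ y) only involves y₀, …, yₙ.
fixedPoint-unique : ∀ u a y z →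
  y ≗ u ⊕ shift (a ∗ y) → z ≗ u ⊕ shift (a ∗ z) → y ≗ z
fixedPoint-unique u a y z y-fix z-fix n = agree n ≤-refl
  where
  agree : ∀ n {i} → i ≤ n → y i ≡ z i
  agree n {zero} _ = trans (y-fix 0) (sym (z-fix 0))
  agree (suc n) {suc i} (s≤s i≤n) = begin
    y (suc i)                 ≡⟨ y-fix (suc i) ⟩
    u (suc i) + (a ∗ y) i     ≡⟨ cong (u (suc i) +_) (∗-congʳ-≤ a i (λ j≤i → agree n (≤-trans j≤i i≤n))) ⟩
    u (suc i) + (a ∗ z) i     ≡⟨ z-fix (suc i) ⟨
    z (suc i)                 ∎

fixedPoint-∗ʳ : ∀ a y u → y ≗ 𝟙 ⊕ shift (a ∗ y) → y ∗ u ≗ u ⊕ shift (a ∗ (y ∗ u))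
fixedPoint-∗ʳ a y u y-fix n = begin
  (y ∗ u) n                                ≡⟨ ∗-congˡ u y-fix n ⟩
  ((𝟙 ⊕ shift (a ∗ y)) ∗ u) n              ≡⟨ ∗-distribʳ-⊕ 𝟙 (shift (a ∗ y)) u n ⟩
  (𝟙 ∗ u) n + (shift (a ∗ y) ∗ u) n        ≡⟨ cong₂ _+_ (∗-identityˡ u n) (∗-shiftˡ (a ∗ y) u n) ⟩
  u n + shift ((a ∗ y) ∗ u) n              ≡⟨ cong (u n +_) (shift-cong (∗-assoc a y u) n) ⟩
  u n + shift (a ∗ (y ∗ u)) n              ∎

-- ballot n k = [xⁿ] cᵏ, by the recursion cᵏ⁺¹ = cᵏ + x cᵏ⁺², that is, cᵏ times c = 1 + x c².
ballot : ℕ → ℕ → ℕ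
ballot zero k = 1
ballot (suc n) zero = 0
ballot (suc n) (suc k) = ballot (suc n) k + ballot n (suc (suc k))

infix 9 c^_

c^_ : ℕ → Series
(c^ k) n = ballot n k

c^0 : c^ 0 ≗ 𝟙
c^0 zero = refl
c^0 (suc n) = refl

c^-suc : ∀ k → c^ suc k ≗ c^ k ⊕ shift (c^ suc (suc k))
c^-suc k zero = refl
c^-suc k (suc n) = refl

c∗c^ : ∀ k → c^ 1 ∗ c^ k ≗ c^ suc k
c∗c^ k zero = refl
c∗c^ zero (suc n) = trans (∗-congʳ (c^ 1) c^0 (suc n)) (∗-identityʳ (c^ 1) (suc n))
c∗c^ (suc k) (suc n) = begin
  (c^ 1 ∗ c^ suc k) (suc n)
    ≡⟨ ∗-congʳ (c^ 1) (c^-suc k) (suc n) ⟩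
  (c^ 1 ∗ (c^ k ⊕ shift (c^ suc (suc k)))) (suc n)
    ≡⟨ ∗-distribˡ-⊕ (c^ 1) (c^ k) (shift (c^ suc (suc k))) (suc n) ⟩
  (c^ 1 ∗ c^ k) (suc n) + (c^ 1 ∗ shift (c^ suc (suc k))) (suc n)
    ≡⟨ cong₂ _+_ (c∗c^ k (suc n)) (∗-shiftʳ (c^ 1) (c^ suc (suc k)) (suc n)) ⟩
  ballot (suc n) (suc k) + (c^ 1 ∗ c^ suc (suc k)) n
    ≡⟨ cong (ballot (suc n) (suc k) +_) (c∗c^ (suc (suc k)) n) ⟩
  ballot (suc n) (suc (suc k)) ∎

n+n+[2+k]≡[1+n]+[1+n]+k : ∀ n k → n + n + suc (suc k) ≡ suc n + suc n + k
n+n+[2+k]≡[1+n]+[1+n]+k = solve-∀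

central : Series
central j = (j + j) C j

-- N C↓ n is N choose n − 1; unlike N C (n ∸ 1) it vanishes at n = 0.
infixl 6.5 _C↓_

_C↓_ : ℕ → ℕ → ℕ
N C↓ zero = 0
N C↓ suc n = N C n

pascal : ∀ N n → suc N C n ≡ N C↓ n + N C n
pascal N zero = refl
pascal N (suc n) = sym (nCk+nC[k+1]≡[n+1]C[k+1] N n)

[1+2n]C[1+n]≡[1+2n]Cn : ∀ n → suc (n + n) C suc n ≡ suc (n + n) C n
[1+2n]C[1+n]≡[1+2n]Cn n =
  trans (nCk≡nC[n∸k] (s≤s (m≤n+m n n))) (cong (suc (n + n) C_) (m+n∸n≡m n n))

c^∗central : ∀ k n → (c^ k ∗ central) n ≡ (n + n + k) C n
c^∗central k zero = refl
c^∗central zero (suc n) = begin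
  (c^ 0 ∗ central) (suc n)     ≡⟨ ∗-congˡ central c^0 (suc n) ⟩
  (𝟙 ∗ central) (suc n)        ≡⟨ ∗-identityˡ central (suc n) ⟩
  (suc n + suc n) C suc n      ≡⟨ cong (_C suc n) (+-identityʳ (suc n + suc n)) ⟨
  (suc n + suc n + 0) C suc n  ∎
c^∗central (suc k) (suc n) = begin
  (c^ suc k ∗ central) (suc n)
    ≡⟨ ∗-congˡ central (c^-suc k) (suc n) ⟩
  ((c^ k ⊕ shift (c^ suc (suc k))) ∗ central) (suc n)
    ≡⟨ ∗-distribʳ-⊕ (c^ k) (shift (c^ suc (suc k))) central (suc n) ⟩
  (c^ k ∗ central) (suc n) + (c^ suc (suc k) ∗ central) n
    ≡⟨ cong₂ _+_ (c^∗central k (suc n)) (c^∗central (suc (suc k)) n) ⟩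
  (suc n + suc n + k) C suc n + (n + n + suc (suc k)) C n
    ≡⟨ cong (λ N → (suc n + suc n + k) C suc n + N C n) (n+n+[2+k]≡[1+n]+[1+n]+k n k) ⟩
  M C suc n + M C n
    ≡⟨ +-comm (M C suc n) (M C n) ⟩
  M C↓ suc n + M C suc n
    ≡⟨ pascal M (suc n) ⟨
  suc M C suc n
    ≡⟨ cong (_C suc n) (+-suc (suc n + suc n) k) ⟨
  (suc n + suc n + suc k) C suc n ∎
  where M = suc n + suc n + k

ballot-binomial : ∀ n k → ballot n (suc k) + (n + n + k) C↓ n ≡ (n + n + k) C n
ballot-binomial zero k = refl
ballot-binomial (suc n) zero = begin
  ballot n 2 + (suc n + suc n + 0) C n
    ≡⟨ cong (λ M → ballot n 2 + M C n) top ⟩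
  ballot n 2 + suc N C n
    ≡⟨ cong (ballot n 2 +_) (pascal N n) ⟩
  ballot n 2 + (N C↓ n + N C n)
    ≡⟨ +-assoc (ballot n 2) (N C↓ n) (N C n) ⟨
  ballot n 2 + N C↓ n + N C n
    ≡⟨ cong (_+ N C n) (subst (λ M → ballot n 2 + M C↓ n ≡ M C n) (+-comm (n + n) 1) (ballot-binomial n 1)) ⟩
  N C n + N C n
    ≡⟨ cong (N C n +_) ([1+2n]C[1+n]≡[1+2n]Cn n) ⟨
  N C n + N C suc n
    ≡⟨ pascal N (suc n) ⟨
  suc N C suc n
    ≡⟨ cong (_C suc n) top ⟨
  (suc n + suc n + 0) C suc n ∎
  where
  N = suc (n + n)
  top : suc n + suc n + 0 ≡ suc N
  top = trans (+-identityʳ (suc n + suc n)) (cong suc (+-suc n n))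
ballot-binomial (suc n) (suc k) = begin
  A + B + (suc n + suc n + suc k) C n
    ≡⟨ cong (λ M → A + B + M C n) (+-suc (suc n + suc n) k) ⟩
  A + B + suc N C n
    ≡⟨ cong (A + B +_) (trans (pascal N n) (+-comm (N C↓ n) (N C n))) ⟩
  A + B + (N C n + N C↓ n)
    ≡⟨ interchange A B (N C n) (N C↓ n) ⟩
  (A + N C n) + (B + N C↓ n)
    ≡⟨ cong₂ _+_ (ballot-binomial (suc n) k) (subst (λ M → B + M C↓ n ≡ M C n) (n+n+[2+k]≡[1+n]+[1+n]+k n k) (ballot-binomial n (suc (suc k)))) ⟩
  N C suc n + N C n
    ≡⟨ trans (+-comm (N C suc n) (N C n)) (sym (pascal N (suc n))) ⟩
  suc N C suc n
    ≡⟨ cong (_C suc n) (+-suc (suc n + suc n) k) ⟨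
  (suc n + suc n + suc k) C suc n ∎
  where
  A = ballot (suc n) (suc k)
  B = ballot n (suc (suc (suc k)))
  N = suc n + suc n + k

[1+k]*[1+n]C[1+k]≡[1+n]*nCk : ∀ n k → suc k * (suc n C suc k) ≡ suc n * (n C k)
[1+k]*[1+n]C[1+k]≡[1+n]*nCk zero zero = refl
[1+k]*[1+n]C[1+k]≡[1+n]*nCk zero (suc k) =
  trans (cong (suc (suc k) *_) (k>n⇒nCk≡0 {1} {suc (suc k)} (s≤s (s≤s z≤n)))) (*-zeroʳ (suc (suc k)))
[1+k]*[1+n]C[1+k]≡[1+n]*nCk (suc n) zero =
  trans (*-identityˡ _) (trans (nC1≡n (suc (suc n))) (sym (*-identityʳ (suc (suc n)))))
[1+k]*[1+n]C[1+k]≡[1+n]*nCk (suc n) (suc k) = begin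
  suc (suc k) * (suc (suc n) C suc (suc k))
    ≡⟨ cong (suc (suc k) *_) (pascal (suc n) (suc (suc k))) ⟩
  suc (suc k) * (z + w)
    ≡⟨ regroup (suc k) z w ⟩
  (suc k * z + z) + suc (suc k) * w
    ≡⟨ cong₂ _+_ (cong (_+ z) ([1+k]*[1+n]C[1+k]≡[1+n]*nCk n k)) ([1+k]*[1+n]C[1+k]≡[1+n]*nCk n (suc k)) ⟩
  (suc n * x + z) + suc n * y
    ≡⟨ collect (suc n) x y z ⟩
  suc n * (x + y) + z
    ≡⟨ cong (λ t → suc n * t + z) (pascal n (suc k)) ⟨
  suc n * z + z
    ≡⟨ +-comm (suc n * z) z ⟩
  suc (suc n) * z ∎
  where
  x = n C k
  y = n C suc k
  z = suc n C suc k
  w = suc n C suc (suc k)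
  regroup : ∀ a z w → suc a * (z + w) ≡ (a * z + z) + suc a * w
  regroup = solve-∀
  collect : ∀ m x y z → (m * x + z) + m * y ≡ m * (x + y) + z
  collect = solve-∀

[1+j]*[2j]C↓j≡j*[2j]Cj : ∀ j → suc j * ((j + j) C↓ j) ≡ j * ((j + j) C j)
[1+j]*[2j]C↓j≡j*[2j]Cj zero = refl
[1+j]*[2j]C↓j≡j*[2j]Cj (suc i) = begin
  suc (suc i) * ((suc i + suc i) C i)  ≡⟨ cong (λ t → suc (suc i) * (t C i)) top ⟩
  suc (suc i) * (N C i)                ≡⟨ cong (suc (suc i) *_) symmetric ⟩
  suc (suc i) * (N C suc (suc i))      ≡⟨ [1+k]*[1+n]C[1+k]≡[1+n]*nCk M (suc i) ⟩
  N * (M C suc i)                      ≡⟨ cong (N *_) ([1+2n]C[1+n]≡[1+2n]Cn i) ⟩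
  N * (M C i)                          ≡⟨ [1+k]*[1+n]C[1+k]≡[1+n]*nCk M i ⟨
  suc i * (N C suc i)                  ≡⟨ cong (λ t → suc i * (t C suc i)) top ⟨
  suc i * ((suc i + suc i) C suc i)    ∎
  where
  M = suc (i + i)
  N = suc M
  top : suc i + suc i ≡ N
  top = cong suc (+-suc i i)
  symmetric : N C i ≡ N C suc (suc i)
  symmetric = trans (nCk≡nC[n∸k] (m≤n⇒m≤o+n 2 (m≤n+m i i)))
    (cong (N C_) (trans (+-∸-assoc 2 (m≤n+m i i)) (cong (2 +_) (m+n∸n≡m i i))))

[1+j]*ballot≡central : ∀ j → suc j * ballot j 1 ≡ central j
[1+j]*ballot≡central j = +-cancelʳ-≡ (j * central j) _ _ (begin
  suc j * ballot j 1 + j * central j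
    ≡⟨ cong (suc j * ballot j 1 +_) ([1+j]*[2j]C↓j≡j*[2j]Cj j) ⟨
  suc j * ballot j 1 + suc j * ((j + j) C↓ j)
    ≡⟨ *-distribˡ-+ (suc j) (ballot j 1) ((j + j) C↓ j) ⟨
  suc j * (ballot j 1 + (j + j) C↓ j)
    ≡⟨ cong (λ N → suc j * (ballot j 1 + N C↓ j)) (+-identityʳ (j + j)) ⟨
  suc j * (ballot j 1 + (j + j + 0) C↓ j)
    ≡⟨ cong (suc j *_) (ballot-binomial j 0) ⟩
  suc j * ((j + j + 0) C j)
    ≡⟨ cong (λ N → suc j * (N C j)) (+-identityʳ (j + j)) ⟩
  central j + j * central j ∎)

catalan≡ballot : ∀ j → catalan j ≡ ballot j 1
catalan≡ballot j = begin
  ((2 * j) C j) / suc j           ≡⟨ cong (λ N → (N C j) / suc j) (cong (j +_) (+-identityʳ j)) ⟩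
  central j / suc j                ≡⟨ cong (_/ suc j) (trans (*-comm (ballot j 1) (suc j)) ([1+j]*ballot≡central j)) ⟨
  ballot j 1 * suc j / suc j       ≡⟨ m*n/n≡m (ballot j 1) (suc j) ⟩
  ballot j 1                       ∎

α-suc : ∀ j → α (suc j) ≡ ballot j 1 + 𝟙 j
α-suc zero = refl
α-suc (suc j) = cong (_+ 0) (catalan≡ballot (suc j))

αFrom : ℕ → Series
αFrom q j = α (q + j)

tail-αFrom : ∀ q → tail (αFrom q) ≗ αFrom (suc q)
tail-αFrom q j = cong α (+-suc q j)

c²-fixedPoint : c^ 2 ≗ 𝟙 ⊕ shift (αFrom 1 ∗ c^ 2)
c²-fixedPoint zero = refl
c²-fixedPoint (suc m) = begin
  ballot m 2 + ballot m 3                  ≡⟨ +-comm (ballot m 2) (ballot m 3) ⟩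
  ballot m 3 + ballot m 2                  ≡⟨ cong₂ _+_ (c∗c^ 2 m) (∗-identityˡ (c^ 2) m) ⟨
  (c^ 1 ∗ c^ 2) m + (𝟙 ∗ c^ 2) m           ≡⟨ ∗-distribʳ-⊕ (c^ 1) 𝟙 (c^ 2) m ⟨
  ((c^ 1 ⊕ 𝟙) ∗ c^ 2) m                    ≡⟨ ∗-congˡ (c^ 2) α-suc m ⟨
  (αFrom 1 ∗ c^ 2) m                       ∎

∂ : Series → Series
∂ a j = suc j * a (suc j)

∂-αFrom : ∀ p → ∂ (αFrom p) ≗ αFrom (suc p) ⊕ shift (∂ (αFrom (suc p)))
∂-αFrom p zero = cong (λ i → α i + 0) (+-suc p 0)
∂-αFrom p (suc j) = cong (λ i → α i + suc j * α i) (+-suc p (suc j))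

∂-αFrom-zero : ∂ (αFrom 0) ≗ central ⊕ 𝟙
∂-αFrom-zero j = begin
  suc j * α (suc j)                    ≡⟨ cong (suc j *_) (α-suc j) ⟩
  suc j * (ballot j 1 + 𝟙 j)           ≡⟨ *-distribˡ-+ (suc j) (ballot j 1) (𝟙 j) ⟩
  suc j * ballot j 1 + suc j * 𝟙 j     ≡⟨ cong₂ _+_ ([1+j]*ballot≡central j) ([1+j]*𝟙≡𝟙 j) ⟩
  central j + 𝟙 j                      ∎
  where
  [1+j]*𝟙≡𝟙 : ∀ j → suc j * 𝟙 j ≡ 𝟙 j
  [1+j]*𝟙≡𝟙 zero = refl
  [1+j]*𝟙≡𝟙 (suc j) = *-zeroʳ (suc (suc j))

-- Reading the edges of the cycle in order: in openWeight t g e, g edges have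
-- been kept since the last deleted one and e − 1 edges were kept before the first
-- deleted one; in cycleWeight s p, the first p edges were kept.
openWeight : ∀ {m} → Subset m → ℕ → ℕ → ℕ
openWeight [] g e = α (g + e)
openWeight (false ∷ t) g e = openWeight t (suc g) e
openWeight (true ∷ t) g e = α (suc g) * openWeight t 0 e

cycleWeight : ∀ {m} → Subset m → ℕ → ℕ
cycleWeight [] p = 0
cycleWeight (true ∷ t) p = openWeight t 0 (suc p)
cycleWeight (false ∷ s) p = cycleWeight s (suc p)

gapsWeight : ℕ → ℕ → List ℕ → ℕ
gapsWeight d c₁ cs = product (map α (gapsFrom d c₁ cs))

cutsWeight : ℕ → List ℕ → ℕ
cutsWeight d [] = 0
cutsWeight d (c ∷ cs) = gapsWeight d c (c ∷ cs)

weight≡cutsWeight : ∀ {d} (S : Subset d) → weight S ≡ cutsWeight d (cutPositions S)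
weight≡cutsWeight {d} S with cutPositions S in eq
... | [] = refl
... | _ ∷ _ = cong (λ cs → product (map α (partSizesOfCuts d cs))) eq

map-+-suc : ∀ q xs → map (q +_) (map suc xs) ≡ map (suc q +_) xs
map-+-suc q xs = trans (sym (map-∘ xs)) (map-cong (+-suc q) xs)

-- c is the last deleted edge and q the next edge to be read.
gapsWeight≡openWeight : ∀ {m} (t : Subset m) g c c₁ q D → q ≡ suc g + c → D ≡ q + m →
  gapsWeight D c₁ (c ∷ map (q +_) (cutPositions t)) ≡ openWeight t g (suc c₁)
gapsWeight≡openWeight [] g c c₁ q D q≡ D≡ =
  trans (*-identityʳ _) (cong α (trans (cong (_+ c₁) D∸c≡1+g) (sym (+-suc g c₁))))
  where
  D∸c≡1+g : D ∸ c ≡ suc g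
  D∸c≡1+g = trans (cong (_∸ c) (trans D≡ (trans (+-identityʳ q) q≡))) (m+n∸n≡m (suc g) c)
gapsWeight≡openWeight {suc m} (false ∷ t) g c c₁ q D q≡ D≡ = trans
  (cong (λ l → gapsWeight D c₁ (c ∷ l)) (map-+-suc q (cutPositions t)))
  (gapsWeight≡openWeight t (suc g) c c₁ (suc q) D (cong suc q≡) (trans D≡ (+-suc q m)))
gapsWeight≡openWeight {suc m} (true ∷ t) g c c₁ q D q≡ D≡ = trans
  (cong (λ l → gapsWeight D c₁ (c ∷ l)) (cong₂ _∷_ (+-identityʳ q) (map-+-suc q (cutPositions t))))
  (cong₂ _*_ (cong α (trans (cong (_∸ c) q≡) (m+n∸n≡m (suc g) c)))
             (gapsWeight≡openWeight t 0 q c₁ (suc q) D refl (trans D≡ (+-suc q m))))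

cutsWeight≡cycleWeight : ∀ {m} (s : Subset m) p →
  cutsWeight (p + m) (map (p +_) (cutPositions s)) ≡ cycleWeight s p
cutsWeight≡cycleWeight [] p = refl
cutsWeight≡cycleWeight {suc m} (false ∷ s) p = trans
  (cong₂ cutsWeight (+-suc p m) (map-+-suc p (cutPositions s)))
  (cutsWeight≡cycleWeight s (suc p))
cutsWeight≡cycleWeight {suc m} (true ∷ t) p = begin
  cutsWeight (p + suc m) ((p + 0) ∷ map (p +_) (map suc (cutPositions t)))
    ≡⟨ cong (λ l → cutsWeight (p + suc m) ((p + 0) ∷ l)) (map-+-suc p (cutPositions t)) ⟩
  gapsWeight (p + suc m) (p + 0) ((p + 0) ∷ map (suc p +_) (cutPositions t))
    ≡⟨ gapsWeight≡openWeight t 0 (p + 0) (p + 0) (suc p) (p + suc m) (cong suc (sym (+-identityʳ p))) (+-suc p m) ⟩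
  openWeight t 0 (suc (p + 0))
    ≡⟨ cong (λ c → openWeight t 0 (suc c)) (+-identityʳ p) ⟩
  openWeight t 0 (suc p) ∎

weight≡cycleWeight : ∀ {d} (S : Subset d) → weight S ≡ cycleWeight S 0
weight≡cycleWeight {d} S = begin
  weight S                                     ≡⟨ weight≡cutsWeight S ⟩
  cutsWeight d (cutPositions S)                ≡⟨ cong (cutsWeight d) (map-id (cutPositions S)) ⟨
  cutsWeight d (map (0 +_) (cutPositions S))   ≡⟨ cutsWeight≡cycleWeight S 0 ⟩
  cycleWeight S 0                              ∎

sumSubsets : (m : ℕ) → (Subset m → ℕ) → ℕ
sumSubsets m f = sum (map f (allSubsets m))

sumSubsets-suc : ∀ m (f : Subset (suc m) → ℕ) →
  sumSubsets (suc m) f ≡ sumSubsets m (f ∘ (true ∷_)) + sumSubsets m (f ∘ (false ∷_))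
sumSubsets-suc m f = begin
  sum (map f (map (true ∷_) xs ++ map (false ∷_) xs))
    ≡⟨ cong sum (map-++ f (map (true ∷_) xs) (map (false ∷_) xs)) ⟩
  sum (map f (map (true ∷_) xs) ++ map f (map (false ∷_) xs))
    ≡⟨ sum-++ (map f (map (true ∷_) xs)) (map f (map (false ∷_) xs)) ⟩
  sum (map f (map (true ∷_) xs)) + sum (map f (map (false ∷_) xs))
    ≡⟨ cong₂ _+_ (cong sum (map-∘ xs)) (cong sum (map-∘ xs)) ⟨
  sumSubsets m (f ∘ (true ∷_)) + sumSubsets m (f ∘ (false ∷_)) ∎
  where xs = allSubsets m

sum-map-*ˡ : ∀ {A : Set} k (f : A → ℕ) xs → sum (map (λ x → k * f x) xs) ≡ k * sum (map f xs)
sum-map-*ˡ k f [] = sym (*-zeroʳ k)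
sum-map-*ˡ k f (x ∷ xs) =
  trans (cong (k * f x +_) (sum-map-*ˡ k f xs)) (sym (*-distribˡ-+ k (f x) _))

openSeries : ℕ → ℕ → Series
openSeries g e m = sumSubsets m (λ t → openWeight t g e)

cycleSeries : ℕ → Series
cycleSeries p m = sumSubsets m (λ s → cycleWeight s p)

openSeries-suc : ∀ g e m →
  openSeries g e (suc m) ≡ openSeries (suc g) e m + α (suc g) * openSeries 0 e m
openSeries-suc g e m = begin
  openSeries g e (suc m)
    ≡⟨ sumSubsets-suc m (λ t → openWeight t g e) ⟩
  sumSubsets m (λ t → α (suc g) * openWeight t 0 e) + openSeries (suc g) e m
    ≡⟨ cong (_+ openSeries (suc g) e m) (sum-map-*ˡ (α (suc g)) (λ t → openWeight t 0 e) (allSubsets m)) ⟩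
  α (suc g) * openSeries 0 e m + openSeries (suc g) e m
    ≡⟨ +-comm (α (suc g) * openSeries 0 e m) (openSeries (suc g) e m) ⟩
  openSeries (suc g) e m + α (suc g) * openSeries 0 e m ∎

openSeries-unfold : ∀ g e → openSeries g e ≗ αFrom (g + e) ⊕ shift (αFrom (suc g) ∗ openSeries 0 e)
openSeries-unfold g e zero = cong (λ i → α i + 0) (sym (+-identityʳ (g + e)))
openSeries-unfold g e (suc m) = begin
  openSeries g e (suc m)
    ≡⟨ openSeries-suc g e m ⟩
  openSeries (suc g) e m + α (suc g) * F m
    ≡⟨ cong (_+ α (suc g) * F m) (openSeries-unfold (suc g) e m) ⟩
  α (suc g + e + m) + shift (αFrom (suc (suc g)) ∗ F) m + α (suc g) * F m
    ≡⟨ xy∙z≈x∙zy (α (suc g + e + m)) (shift (αFrom (suc (suc g)) ∗ F) m) (α (suc g) * F m) ⟩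
  α (suc g + e + m) + (α (suc g) * F m + shift (αFrom (suc (suc g)) ∗ F) m)
    ≡⟨ cong₂ _+_ (cong α (+-suc (g + e) m))
                 (cong₂ _+_ (cong (λ i → α i * F m) (+-identityʳ (suc g)))
                            (shift-cong (∗-congˡ F (tail-αFrom (suc g))) m)) ⟨
  α (g + e + suc m) + (αFrom (suc g) 0 * F m + shift (tail (αFrom (suc g)) ∗ F) m)
    ≡⟨ cong (α (g + e + suc m) +_) (∗-unfoldˡ (αFrom (suc g)) F m) ⟨
  α (g + e + suc m) + (αFrom (suc g) ∗ F) m ∎
  where F = openSeries 0 e

openSeries≗c²∗αFrom : ∀ e → openSeries 0 e ≗ c^ 2 ∗ αFrom e
openSeries≗c²∗αFrom e = fixedPoint-unique (αFrom e) (αFrom 1) (openSeries 0 e) (c^ 2 ∗ αFrom e)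
  (openSeries-unfold 0 e) (fixedPoint-∗ʳ (αFrom 1) (c^ 2) (αFrom e) c²-fixedPoint)

cycleSeries-unfold : ∀ p → cycleSeries p ≗ shift (c^ 2 ∗ ∂ (αFrom p))
cycleSeries-unfold p zero = refl
cycleSeries-unfold p (suc m) = begin
  cycleSeries p (suc m)
    ≡⟨ sumSubsets-suc m (λ s → cycleWeight s p) ⟩
  openSeries 0 (suc p) m + cycleSeries (suc p) m
    ≡⟨ cong₂ _+_ (openSeries≗c²∗αFrom (suc p) m) (cycleSeries-unfold (suc p) m) ⟩
  (c^ 2 ∗ αFrom (suc p)) m + shift (c^ 2 ∗ ∂ (αFrom (suc p))) m
    ≡⟨ cong ((c^ 2 ∗ αFrom (suc p)) m +_) (∗-shiftʳ (c^ 2) (∂ (αFrom (suc p))) m) ⟨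
  (c^ 2 ∗ αFrom (suc p)) m + (c^ 2 ∗ shift (∂ (αFrom (suc p)))) m
    ≡⟨ ∗-distribˡ-⊕ (c^ 2) (αFrom (suc p)) (shift (∂ (αFrom (suc p)))) m ⟨
  (c^ 2 ∗ (αFrom (suc p) ⊕ shift (∂ (αFrom (suc p))))) m
    ≡⟨ ∗-congʳ (c^ 2) (∂-αFrom p) m ⟨
  (c^ 2 ∗ ∂ (αFrom p)) m ∎

lemma3p3 : (d : ℕ) → ((2 * suc d) C suc d) ≡ cyclicSum (suc d)
lemma3p3 d = sym (begin
  cyclicSum (suc d)
    ≡⟨ cong sum (map-cong weight≡cycleWeight (allSubsets (suc d))) ⟩
  cycleSeries 0 (suc d)
    ≡⟨ cycleSeries-unfold 0 (suc d) ⟩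
  (c^ 2 ∗ ∂ (αFrom 0)) d
    ≡⟨ ∗-congʳ (c^ 2) ∂-αFrom-zero d ⟩
  (c^ 2 ∗ (central ⊕ 𝟙)) d
    ≡⟨ ∗-distribˡ-⊕ (c^ 2) central 𝟙 d ⟩
  (c^ 2 ∗ central) d + (c^ 2 ∗ 𝟙) d
    ≡⟨ cong₂ _+_ (c^∗central 2 d) (∗-identityʳ (c^ 2) d) ⟩
  (d + d + 2) C d + ballot d 2
    ≡⟨ +-comm ((d + d + 2) C d) (ballot d 2) ⟩
  ballot d 2 + (d + d + 2) C d
    ≡⟨ cong (λ N → ballot d 2 + N C d) (n+n+[2+k]≡[1+n]+[1+n]+k d 0) ⟩
  ballot (suc d) 1 + (suc d + suc d + 0) C↓ suc d
    ≡⟨ ballot-binomial (suc d) 0 ⟩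
  (suc d + suc d + 0) C suc d
    ≡⟨ cong (_C suc d) (+-assoc (suc d) (suc d) 0) ⟩
  (2 * suc d) C suc d ∎)
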